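{- For each nonnegative integer $k$, $|\mathcal U_{2k+1}(321)|=C_k$, where $C_k=\frac{1}{k+1}\binom{2k}{k}$.
   Context: The stack-sorting map $s$ on permutations (finite words of distinct positive integers): $s(\text{empty})=\text{empty}$, and if $\pi=LnR$ with $n$ the largest entry, $s(\pi)=s(L)s(R)n$. A permutation is uniquely sorted if it has exactly one preimage under $s$. A permutation avoids $\tau$ if no subsequence has the same relative order as $\tau$; $\mathcal U_n(\tau)$ is the set of uniquely sorted permutations of $[n]$ avoiding $\tau$. -}

module Defs where

open import Data.Nat using (ℕ; zero; suc; _+_; _*_; _<_; _≤_; _⊔_; _≡ᵇ_)
open import Data.Nat.Combinatorics using (_C_)
open import Data.Nat.DivMod using (_/_)
open import Data.List using (List; []; _∷_; _++_; length; foldr; upTo; map; lookup)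
open import Data.List.Relation.Unary.Unique.Propositional using (Unique)
open import Data.List.Relation.Binary.Permutation.Propositional using (_↭_)
open import Data.List.Relation.Binary.Sublist.Propositional using (_⊆_)
open import Data.List.Membership.Propositional using (_∈_)
open import Data.Fin using (Fin)
open import Data.Bool using (Bool; true; false; if_then_else_)
open import Data.Product using (Σ; _×_; ∃; ∃-syntax)
open import Function.Bundles using (_⇔_)
open import Relation.Binary.PropositionalEquality using (_≡_)
open import Relation.Nullary using (¬_)

range : ℕ → List ℕ
range n = map suc (upTo n)

IsPerm : ℕ → List ℕ → Set
IsPerm n π = π ↭ range n

-- largest entry (0 for the empty word; entries are positive)
maxEntry : List ℕ → ℕ
maxEntry = foldr _⊔_ 0

splitAt : ℕ → List ℕ → List ℕ × List ℕ
splitAt m [] = [] Data.Product., []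
splitAt m (x ∷ w) = if x ≡ᵇ m then ([] Data.Product., w)
  else (x ∷ Data.Product.proj₁ (splitAt m w)) Data.Product., Data.Product.proj₂ (splitAt m w)

-- stack-sorting map with fuel (fuel = length suffices)
sFuel : ℕ → List ℕ → List ℕ
sFuel zero w = []
sFuel (suc f) [] = []
sFuel (suc f) (x ∷ w) =
  let n = maxEntry (x ∷ w)
      p = splitAt n (x ∷ w)
  in sFuel f (Data.Product.proj₁ p) ++ sFuel f (Data.Product.proj₂ p) ++ (n ∷ [])

-- s(empty) = empty, s(L n R) = s(L) s(R) n with n the largest entry
s : List ℕ → List ℕ
s w = sFuel (length w) w

UniquelySorted : ℕ → List ℕ → Set
UniquelySorted n π =
  Σ (List ℕ) (λ σ → (IsPerm n σ × s σ ≡ π)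
     × (∀ σ' → IsPerm n σ' → s σ' ≡ π → σ' ≡ σ))

SameOrder : List ℕ → List ℕ → Set
SameOrder u v = Σ (length u ≡ length v) λ _ →
  ∀ (i j : Fin (length u)) (i' j' : Fin (length v)) →
    Data.Fin.toℕ i ≡ Data.Fin.toℕ i' → Data.Fin.toℕ j ≡ Data.Fin.toℕ j' →
    (lookup u i < lookup u j) ⇔ (lookup v i' < lookup v j')

Contains : List ℕ → List ℕ → Set
Contains π τ = ∃[ w ] (w ⊆ π × SameOrder w τ)

Avoids : List ℕ → List ℕ → Set
Avoids π τ = ¬ Contains π τ

InU : ℕ → List ℕ → List ℕ → Set
InU n τ π = IsPerm n π × UniquelySorted n π × Avoids π τ

catalan : ℕ → ℕ
catalan k = ((2 * k) C k) / suc k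

HasCard : (List ℕ → Set) → ℕ → Set
HasCard P c = Σ (List (List ℕ)) λ L → Unique L × length L ≡ c × (∀ π → (π ∈ L) ⇔ P π)

-- Uniquely sorted 321-avoiding permutations of [2k+1] are exactly the "ladders"
-- aₖ cₖ ⋯ a₁ c₁ a₀ with a₀ > a₁ > ⋯ > aₖ, cᵢ < aᵢ and cₖ < ⋯ < c₁. A ladder has the unique
-- preimage aₖ aₖ₋₁ cₖ ⋯ a₀ c₁. Conversely, write the unique preimage as σ = L n R with n maximal,
-- so that s σ = s(L) s(R) n. Then s(L) s(R) has no preimage unless it is empty; by induction s(L)
-- and s(R) are ladders, and s(R) must be a single entry below the top of s(L): a larger top would
-- produce a preimage of s(L) s(R), and a further rung of s(R) a 321 pattern with the top of s(L).
-- The pairs (a₁ ⋯ aₖ, c₁ ⋯ cₖ) are the rows of the standard Young tableaux of shape (k, k) on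
-- [2k], counted by the ballot numbers, whose value at (k, k) is Cₖ.
module Submission where

open import Defs
open import Data.Bool using (true; false; T)
open import Data.Empty using (⊥; ⊥-elim)
open import Data.Fin as Fin using ()
open import Data.Fin.Properties using (toℕ-injective)
open import Data.Nat using (ℕ; zero; suc; _+_; _*_; _∸_; _≤_; _<_; _>_; _≡ᵇ_; _≤?_; z≤n; s≤s)
open import Data.Nat.Properties
open import Data.Nat.Combinatorics using (_C_; nCk+nC[k+1]≡[n+1]C[k+1]; nCk≡nC[n∸k]; nC1≡n; k>n⇒nCk≡0)
open import Data.Nat.DivMod using (_/_; m*n/n≡m)
open import Data.Nat.Tactic.RingSolver using (solve-∀)
open import Data.Product using (Σ-syntax; _×_; _,_; proj₁; proj₂; ∃; ∃₂; uncurry; map₁; map₂)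
open import Data.Sum using (_⊎_; inj₁; inj₂)
open import Function.Bundles using (_⇔_; mk⇔; Equivalence)
open import Function.Properties.Equivalence using () renaming (trans to ⇔-trans; sym to ⇔-sym)
open import Relation.Binary.Definitions using (tri<; tri≈; tri>)
open import Relation.Binary.PropositionalEquality
  using (_≡_; _≢_; refl; sym; trans; cong; cong₂; subst; setoid; module ≡-Reasoning)
open import Relation.Nullary using (¬_; yes; no)

open import Data.List using (List; []; _∷_; [_]; _++_; _∷ʳ_; length; map; drop; lookup; upTo; initLast; _∷ʳ′_)
open import Data.List.Properties
  using ( ++-assoc; ++-identityʳ; ++-cancelˡ; ++-cancelʳ; ++-conicalˡ; ++-conicalʳ; ∷-injectiveˡ; ∷-injectiveʳ
        ; ∷ʳ-injective; length-++; length-map; map-++; upTo-∷ʳ; length-upTo)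
open import Data.List.Membership.Propositional using (_∈_)
open import Data.List.Membership.Propositional.Properties using (∈-++⁺ˡ; ∈-++⁺ʳ; ∈-++⁻; ∈-map⁺; ∈-map⁻)
open import Data.List.Relation.Unary.All as All using (All; []; _∷_)
open import Data.List.Relation.Unary.All.Properties as All using ()
open import Data.List.Relation.Unary.AllPairs using (AllPairs; []; _∷_)
open import Data.List.Relation.Unary.Any using (here; there)
open import Data.List.Relation.Unary.Unique.Propositional using (Unique)
import Data.List.Relation.Unary.Unique.Propositional.Properties as Unique
open import Data.List.Relation.Binary.Pointwise using (Pointwise; []; _∷_; Pointwise-length)
open import Data.List.Relation.Binary.Permutation.Propositional
  using (_↭_; ↭-refl; ↭-sym; ↭-trans; ↭-reflexive; prep; swap; ↭⇒↭ₛ; module PermutationReasoning)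
open import Data.List.Relation.Binary.Permutation.Propositional.Properties
  using (++⁺; ++⁺ˡ; ++⁺ʳ; shift; ∷↭∷ʳ; ↭-length; ∈-resp-↭; All-resp-↭; drop-mid; ↭-singleton-inv)
open import Data.List.Relation.Binary.Permutation.Setoid.Properties (setoid ℕ) using (Unique-resp-↭)
open import Data.List.Relation.Binary.Sublist.Propositional as ⊆ using (_⊆_; []; _∷_; ⊆-refl; ⊆-trans; from∈)
import Data.List.Relation.Binary.Sublist.Propositional.Properties as Sublist

length-split : ∀ {A : Set} {x : A} {w} L m R → x ∷ w ≡ L ++ m ∷ R → length L ≤ length w × length R ≤ length w
length-split {w = w} L m R eq =
  ≤-trans (m≤m+n _ _) (≤-reflexive L+R≡w) , ≤-trans (m≤n+m _ _) (≤-reflexive L+R≡w)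
  where
  L+R≡w : length L + length R ≡ length w
  L+R≡w = suc-injective (trans (sym (+-suc _ _)) (sym (trans (cong length eq) (length-++ L))))

Unique-⊆ : ∀ {A : Set} {P Q : List A} → P ⊆ Q → Unique Q → Unique P
Unique-⊆ [] u = u
Unique-⊆ (y ⊆.∷ʳ P⊆Q) (_ ∷ u) = Unique-⊆ P⊆Q u
Unique-⊆ (refl ∷ P⊆Q) (x∉Q ∷ u) = Sublist.All-resp-⊆ P⊆Q x∉Q ∷ Unique-⊆ P⊆Q u

Unique-++⇒≢ : ∀ {A : Set} (P : List A) {Q x y} → Unique (P ++ Q) → x ∈ P → y ∈ Q → x ≢ y
Unique-++⇒≢ (p ∷ P) (p∉ ∷ _) (here refl) y∈Q = All.lookup p∉ (∈-++⁺ʳ P y∈Q)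
Unique-++⇒≢ (p ∷ P) (_ ∷ u) (there x∈P) y∈Q = Unique-++⇒≢ P u x∈P y∈Q

Unique-∷ʳ⇒< : ∀ {π m} → Unique (π ∷ʳ m) → All (_≤ m) π → All (_< m) π
Unique-∷ʳ⇒< {π} u π≤m = All.tabulate λ y∈π → ≤∧≢⇒< (All.lookup π≤m y∈π) (Unique-++⇒≢ π u y∈π (here refl))

Unique-map⁺-on : ∀ {X Y : Set} (f : X → Y) {xs} → (∀ {x y} → x ∈ xs → y ∈ xs → f x ≡ f y → x ≡ y) →
  Unique xs → Unique (map f xs)
Unique-map⁺-on f {[]} _ [] = []
Unique-map⁺-on f {x ∷ xs} injective (x∉xs ∷ u) =
  All.tabulate (λ z∈ fx≡z → let (y , y∈xs , z≡fy) = ∈-map⁻ f z∈ in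
                 All.lookup x∉xs y∈xs (injective (here refl) (there y∈xs) (trans fx≡z z≡fy)))
  ∷ Unique-map⁺-on f (λ x∈ y∈ → injective (there x∈) (there y∈)) u

⊆-∷ʳ⁻ : ∀ {A : Set} {xs : List A} w {v} → xs ⊆ w ∷ʳ v → xs ⊆ w ⊎ ∃ λ xs' → xs ≡ xs' ∷ʳ v × xs' ⊆ w
⊆-∷ʳ⁻ [] (_ ⊆.∷ʳ []) = inj₁ []
⊆-∷ʳ⁻ [] (refl ∷ []) = inj₂ ([] , refl , [])
⊆-∷ʳ⁻ (y ∷ w) (.y ⊆.∷ʳ p) with ⊆-∷ʳ⁻ w p
... | inj₁ q = inj₁ (y ⊆.∷ʳ q)
... | inj₂ (xs' , eq , q) = inj₂ (xs' , eq , y ⊆.∷ʳ q)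
⊆-∷ʳ⁻ (y ∷ w) (refl ∷ p) with ⊆-∷ʳ⁻ w p
... | inj₁ q = inj₁ (refl ∷ q)
... | inj₂ (xs' , eq , q) = inj₂ (y ∷ xs' , cong (y ∷_) eq , refl ∷ q)

pair-⊆-∷ʳ⁻ : ∀ {A : Set} {x y v : A} w → x ∷ [ y ] ⊆ w ∷ʳ v → x ∷ [ y ] ⊆ w ⊎ (x ∈ w × y ≡ v)
pair-⊆-∷ʳ⁻ w p with ⊆-∷ʳ⁻ w p
... | inj₁ q = inj₁ q
... | inj₂ (xs' , eq , q) with ∷ʳ-injective [ _ ] xs' eq
...   | refl , y≡v = inj₂ (⊆.to∈ q , y≡v)

triple-⊆-∷ʳ⁻ : ∀ {A : Set} {x y z v : A} w → x ∷ y ∷ [ z ] ⊆ w ∷ʳ v → x ∷ y ∷ [ z ] ⊆ w ⊎ (x ∷ [ y ] ⊆ w × z ≡ v)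
triple-⊆-∷ʳ⁻ w p with ⊆-∷ʳ⁻ w p
... | inj₁ q = inj₁ q
... | inj₂ (xs' , eq , q) with ∷ʳ-injective (_ ∷ [ _ ]) xs' eq
...   | refl , z≡v = inj₂ (q , z≡v)

drop-∷ : ∀ {X : Set} d (xs : List X) → d < length xs → ∃ λ x → x ∈ xs × drop d xs ≡ x ∷ drop (suc d) xs
drop-∷ zero (x ∷ xs) _ = x , here refl , refl
drop-∷ (suc d) (x ∷ xs) (s≤s d<xs) = let (y , y∈ , eq) = drop-∷ d xs d<xs in y , there y∈ , eq

Pointwise-drop⁻ : ∀ {X Y : Set} {R : X → Y → Set} d (xs : List X) {y ys} →
  Pointwise R (drop d xs) (y ∷ ys) → Pointwise R (drop (suc d) xs) ys
Pointwise-drop⁻ zero (x ∷ xs) (_ ∷ xs~ys) = xs~ys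
Pointwise-drop⁻ (suc d) (x ∷ xs) xs~ys = Pointwise-drop⁻ d xs xs~ys

drop-suc∸ : ∀ {X : Set} {p q} x (B : List X) → q ≤ p → drop (suc p ∸ q) (x ∷ B) ≡ drop (p ∸ q) B
drop-suc∸ x B q≤p = cong (λ d → drop d (x ∷ B)) (+-∸-assoc 1 q≤p)

m+m≡n+n⇒m≡n : ∀ {m n} → m + m ≡ n + n → m ≡ n
m+m≡n+n⇒m≡n {m} {n} eq with <-cmp m n
... | tri< m<n _ _ = ⊥-elim (<-irrefl eq (+-mono-< m<n m<n))
... | tri≈ _ m≡n _ = m≡n
... | tri> _ _ n<m = ⊥-elim (<-irrefl (sym eq) (+-mono-< n<m n<m))

≡ᵇ-refl : ∀ m → (m ≡ᵇ m) ≡ true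
≡ᵇ-refl zero = refl
≡ᵇ-refl (suc m) = ≡ᵇ-refl m

≡ᵇ-true⇒≡ : ∀ {x m} → (x ≡ᵇ m) ≡ true → x ≡ m
≡ᵇ-true⇒≡ {x} {m} eq = ≡ᵇ⇒≡ x m (subst T (sym eq) _)

≡ᵇ-false⇒≢ : ∀ {x m} → (x ≡ᵇ m) ≡ false → x ≢ m
≡ᵇ-false⇒≢ {x} eq refl = subst T eq (≡⇒≡ᵇ x x refl)

Decreasing : List ℕ → Set
Decreasing = AllPairs _>_

-- Stack sorting

maxEntry-ub : ∀ {x} w → x ∈ w → x ≤ maxEntry w
maxEntry-ub (y ∷ w) (here refl) = m≤m⊔n y (maxEntry w)
maxEntry-ub (y ∷ w) (there x∈w) = ≤-trans (maxEntry-ub w x∈w) (m≤n⊔m y (maxEntry w))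

maxEntry-lub : ∀ {m} w → All (_≤ m) w → maxEntry w ≤ m
maxEntry-lub [] [] = z≤n
maxEntry-lub (x ∷ w) (x≤m ∷ w≤m) = ⊔-lub x≤m (maxEntry-lub w w≤m)

maxEntry-∈ : ∀ x w → maxEntry (x ∷ w) ∈ x ∷ w
maxEntry-∈ x [] rewrite ⊔-identityʳ x = here refl
maxEntry-∈ x (y ∷ w) with ⊔-sel x (maxEntry (y ∷ w))
... | inj₁ e rewrite e = here refl
... | inj₂ e rewrite e = there (maxEntry-∈ y w)

maxEntry-mid : ∀ L n R → All (_≤ n) L → All (_≤ n) R → maxEntry (L ++ n ∷ R) ≡ n
maxEntry-mid L n R L≤n R≤n = ≤-antisym
  (maxEntry-lub (L ++ n ∷ R) (All.++⁺ L≤n (≤-refl ∷ R≤n)))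
  (maxEntry-ub (L ++ n ∷ R) (∈-++⁺ʳ L (here refl)))

splitAt-mid : ∀ m L R → All (_≢ m) L → splitAt m (L ++ m ∷ R) ≡ (L , R)
splitAt-mid m [] R [] rewrite ≡ᵇ-refl m = refl
splitAt-mid m (x ∷ L) R (x≢m ∷ L≢m) with x ≡ᵇ m in eq
... | true = ⊥-elim (x≢m (≡ᵇ-true⇒≡ eq))
... | false rewrite splitAt-mid m L R L≢m = refl

splitAt-∈ : ∀ m w → m ∈ w →
  w ≡ proj₁ (splitAt m w) ++ m ∷ proj₂ (splitAt m w) × All (_≢ m) (proj₁ (splitAt m w))
splitAt-∈ m (x ∷ w) m∈x∷w with x ≡ᵇ m in eq | m∈x∷w
... | true  | _ = cong (_∷ w) (≡ᵇ-true⇒≡ eq) , []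
... | false | here refl = ⊥-elim (≡ᵇ-false⇒≢ {m} eq refl)
... | false | there m∈w =
  let (w≡LmR , L≢m) = splitAt-∈ m w m∈w in cong (x ∷_) w≡LmR , ≡ᵇ-false⇒≢ eq ∷ L≢m

leftOfMax rightOfMax : ℕ → List ℕ → List ℕ
leftOfMax x w = proj₁ (splitAt (maxEntry (x ∷ w)) (x ∷ w))
rightOfMax x w = proj₂ (splitAt (maxEntry (x ∷ w)) (x ∷ w))

splitAtMax : ∀ x w → x ∷ w ≡ leftOfMax x w ++ maxEntry (x ∷ w) ∷ rightOfMax x w
splitAtMax x w = proj₁ (splitAt-∈ (maxEntry (x ∷ w)) (x ∷ w) (maxEntry-∈ x w))

maxEntry-bounds : ∀ x w → All (_≤ maxEntry (x ∷ w)) (leftOfMax x w ++ maxEntry (x ∷ w) ∷ rightOfMax x w)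
maxEntry-bounds x w = subst (All (_≤ maxEntry (x ∷ w))) (splitAtMax x w) (All.tabulate (maxEntry-ub (x ∷ w)))

leftOfMax-< : ∀ x w → All (_< maxEntry (x ∷ w)) (leftOfMax x w)
leftOfMax-< x w = All.zipWith (λ (y≤m , y≢m) → ≤∧≢⇒< y≤m y≢m) (L≤m , L≢m)
  where
  L≤m = All.++⁻ˡ (leftOfMax x w) (maxEntry-bounds x w)
  L≢m = proj₂ (splitAt-∈ (maxEntry (x ∷ w)) (x ∷ w) (maxEntry-∈ x w))

rightOfMax-≤ : ∀ x w → All (_≤ maxEntry (x ∷ w)) (rightOfMax x w)
rightOfMax-≤ x w = All.tail (All.++⁻ʳ (leftOfMax x w) (maxEntry-bounds x w))

length-leftOfMax : ∀ x w → length (leftOfMax x w) ≤ length w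
length-leftOfMax x w = proj₁ (length-split (leftOfMax x w) _ (rightOfMax x w) (splitAtMax x w))

length-rightOfMax : ∀ x w → length (rightOfMax x w) ≤ length w
length-rightOfMax x w = proj₂ (length-split (leftOfMax x w) _ (rightOfMax x w) (splitAtMax x w))

sFuel-[] : ∀ f → sFuel f [] ≡ []
sFuel-[] zero = refl
sFuel-[] (suc f) = refl

sFuel-irrelevant : ∀ f g w → length w ≤ f → length w ≤ g → sFuel f w ≡ sFuel g w
sFuel-irrelevant f g [] _ _ = trans (sFuel-[] f) (sym (sFuel-[] g))
sFuel-irrelevant (suc f) (suc g) (x ∷ w) (s≤s w≤f) (s≤s w≤g) =
  cong₂ (λ u v → u ++ v ++ [ maxEntry (x ∷ w) ])
    (sFuel-irrelevant f g _ (≤-trans L≤w w≤f) (≤-trans L≤w w≤g))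
    (sFuel-irrelevant f g _ (≤-trans R≤w w≤f) (≤-trans R≤w w≤g))
  where
  L≤w = length-leftOfMax x w
  R≤w = length-rightOfMax x w

s-unfold : ∀ x w → s (x ∷ w) ≡ s (leftOfMax x w) ++ s (rightOfMax x w) ++ [ maxEntry (x ∷ w) ]
s-unfold x w = cong₂ (λ u v → u ++ v ++ [ maxEntry (x ∷ w) ])
  (sFuel-irrelevant (length w) _ _ (length-leftOfMax x w) ≤-refl)
  (sFuel-irrelevant (length w) _ _ (length-rightOfMax x w) ≤-refl)

s-at-max : ∀ x w L n R → x ∷ w ≡ L ++ n ∷ R → All (_< n) L → All (_≤ n) R →
  s (x ∷ w) ≡ s L ++ s R ++ [ n ]
s-at-max x w L n R eq L<n R≤n =
  trans (s-unfold x w) (cong (λ (L , n , R) → s L ++ s R ++ [ n ]) split≡)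
  where
  max≡ : maxEntry (x ∷ w) ≡ n
  max≡ = trans (cong maxEntry eq) (maxEntry-mid L n R (All.map <⇒≤ L<n) R≤n)
  splitAt≡ : splitAt (maxEntry (x ∷ w)) (x ∷ w) ≡ (L , R)
  splitAt≡ = trans (cong₂ splitAt max≡ eq) (splitAt-mid n L R (All.map <⇒≢ L<n))
  split≡ : (leftOfMax x w , maxEntry (x ∷ w) , rightOfMax x w) ≡ (L , n , R)
  split≡ = cong₂ (λ (L , R) n → L , n , R) splitAt≡ max≡

s-split : ∀ L n R → All (_< n) L → All (_≤ n) R → s (L ++ n ∷ R) ≡ s L ++ s R ++ [ n ]
s-split [] n R = s-at-max n R [] n R refl
s-split (x ∷ L) n R = s-at-max x (L ++ n ∷ R) (x ∷ L) n R refl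

s-[_] : ∀ x → s [ x ] ≡ [ x ]
s-[ x ] = s-split [] x [] [] []

sFuel-↭ : ∀ f w → length w ≤ f → sFuel f w ↭ w
sFuel-↭ f [] _ rewrite sFuel-[] f = ↭-refl
sFuel-↭ (suc f) (x ∷ w) (s≤s w≤f) = begin
  sFuel f L ++ sFuel f R ++ [ m ] ↭⟨ ++⁺ (sFuel-↭ f L L≤f) (++⁺ʳ [ m ] (sFuel-↭ f R R≤f)) ⟩
  L ++ R ++ [ m ]                 ↭⟨ ++⁺ˡ L (↭-sym (∷↭∷ʳ m R)) ⟩
  L ++ m ∷ R                      ≡⟨ splitAtMax x w ⟨
  x ∷ w                           ∎
  where
  open PermutationReasoning
  L = leftOfMax x w
  R = rightOfMax x w
  m = maxEntry (x ∷ w)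
  L≤f = ≤-trans (length-leftOfMax x w) w≤f
  R≤f = ≤-trans (length-rightOfMax x w) w≤f

s-↭ : ∀ w → s w ↭ w
s-↭ w = sFuel-↭ (length w) w ≤-refl

All-s⁺ : ∀ {P : ℕ → Set} w → All P w → All P (s w)
All-s⁺ w = All-resp-↭ (↭-sym (s-↭ w))

All-s⁻ : ∀ {P : ℕ → Set} w → All P (s w) → All P w
All-s⁻ w = All-resp-↭ (s-↭ w)

∈-s⁻ : ∀ {x} w → x ∈ s w → x ∈ w
∈-s⁻ w = ∈-resp-↭ (s-↭ w)

s≡[]⇒≡[] : ∀ w → s w ≡ [] → w ≡ []
s≡[]⇒≡[] [] _ = refl
s≡[]⇒≡[] (x ∷ w) eq with () ← trans (sym (cong length eq)) (↭-length (s-↭ (x ∷ w)))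

s-∷ʳ-inv : ∀ x w {Y n} → s (x ∷ w) ≡ Y ∷ʳ n →
  s (leftOfMax x w) ++ s (rightOfMax x w) ≡ Y × maxEntry (x ∷ w) ≡ n
s-∷ʳ-inv x w eq = ∷ʳ-injective (s (leftOfMax x w) ++ s (rightOfMax x w)) _
  (trans (sym (trans (s-unfold x w) (sym (++-assoc (s (leftOfMax x w)) _ _)))) eq)

s-last≡maxEntry : ∀ w {Y z} → s w ≡ Y ∷ʳ z → z ≡ maxEntry w
s-last≡maxEntry [] {Y} eq with () ← ++-conicalʳ Y _ (sym eq)
s-last≡maxEntry (x ∷ w) eq = sym (proj₂ (s-∷ʳ-inv x w eq))

≤-last-s : ∀ w {Y y z} → s w ≡ Y ∷ʳ z → y ∈ s w → y ≤ z
≤-last-s w eq y∈sw = subst (_ ≤_) (sym (s-last≡maxEntry w eq)) (maxEntry-ub w (∈-s⁻ w y∈sw))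

-- ladder (a₁ ∷ ⋯ ∷ aₖ) (c₁ ∷ ⋯ ∷ cₖ) a₀ is the word aₖ cₖ ⋯ a₁ c₁ a₀; Ladder asks for
-- a₀ > a₁ > ⋯ > aₖ and cᵢ < aᵢ.
data Ladder : List ℕ → List ℕ → ℕ → Set where
  []   : ∀ {n} → Ladder [] [] n
  rung : ∀ {A B m c n} → Ladder A B m → c < m → m < n → Ladder (m ∷ A) (c ∷ B) n

ladder : List ℕ → List ℕ → ℕ → List ℕ
ladder (m ∷ A) (c ∷ B) n = ladder A B m ++ c ∷ n ∷ []
ladder _ _ n = [ n ]

ladderPreimage : List ℕ → List ℕ → ℕ → List ℕ
ladderPreimage (m ∷ A) (c ∷ B) n = ladderPreimage A B m ++ n ∷ c ∷ []
ladderPreimage _ _ n = [ n ]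

ladder-rung : ∀ m A c B n → ladder (m ∷ A) (c ∷ B) n ≡ ladder A B m ∷ʳ c ∷ʳ n
ladder-rung m A c B n = sym (++-assoc (ladder A B m) [ c ] [ n ])

ladder-∷ʳ : ∀ A B n → ∃ λ X → ladder A B n ≡ X ∷ʳ n
ladder-∷ʳ (m ∷ A) (c ∷ B) n = ladder A B m ∷ʳ c , ladder-rung m A c B n
ladder-∷ʳ [] B n = [] , refl
ladder-∷ʳ (m ∷ A) [] n = [] , refl

ladder≡⇒top≡ : ∀ A B {m} A' B' {m'} → ladder A B m ≡ ladder A' B' m' → m ≡ m'
ladder≡⇒top≡ A B {m} A' B' {m'} eq = proj₂ (∷ʳ-injective (proj₁ (ladder-∷ʳ A B m)) (proj₁ (ladder-∷ʳ A' B' m'))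
  (trans (sym (proj₂ (ladder-∷ʳ A B m))) (trans eq (proj₂ (ladder-∷ʳ A' B' m')))))

∈-ladder : ∀ A B n → n ∈ ladder A B n
∈-ladder A B n = subst (n ∈_) (sym (proj₂ (ladder-∷ʳ A B n))) (∈-++⁺ʳ _ (here refl))

ladder-≤ : ∀ {A B n} → Ladder A B n → All (_≤ n) (ladder A B n)
ladder-≤ [] = ≤-refl ∷ []
ladder-≤ (rung l c<m m<n) =
  All.++⁺ (All.map (λ x≤m → ≤-trans x≤m (<⇒≤ m<n)) (ladder-≤ l)) (<⇒≤ (<-trans c<m m<n) ∷ ≤-refl ∷ [])

ladder-< : ∀ {A B m n} → Ladder A B m → m < n → All (_< n) (ladder A B m)
ladder-< l m<n = All.map (λ x≤m → ≤-<-trans x≤m m<n) (ladder-≤ l)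

ladderPreimage-↭ : ∀ A B n → ladderPreimage A B n ↭ ladder A B n
ladderPreimage-↭ (m ∷ A) (c ∷ B) n = ++⁺ (ladderPreimage-↭ A B m) (swap n c ↭-refl)
ladderPreimage-↭ [] B n = ↭-refl
ladderPreimage-↭ (m ∷ A) [] n = ↭-refl

ladder-↭ : ∀ {A B n} → Ladder A B n → ladder A B n ↭ n ∷ A ++ B
ladder-↭ [] = ↭-refl
ladder-↭ (rung {A} {B} {m} {c} {n} l _ _) = begin
  ladder A B m ++ c ∷ [ n ]      ↭⟨ ++⁺ʳ (c ∷ [ n ]) (ladder-↭ l) ⟩
  (m ∷ A ++ B) ++ c ∷ [ n ]      ≡⟨ ++-assoc (m ∷ A ++ B) [ c ] [ n ] ⟨
  (m ∷ A ++ B) ∷ʳ c ∷ʳ n         ↭⟨ ∷↭∷ʳ n _ ⟨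
  n ∷ m ∷ (A ++ B) ∷ʳ c          ≡⟨ cong (λ xs → n ∷ m ∷ xs) (++-assoc A B [ c ]) ⟩
  n ∷ m ∷ A ++ B ∷ʳ c            ↭⟨ prep n (prep m (++⁺ˡ A (↭-sym (∷↭∷ʳ c B)))) ⟩
  n ∷ m ∷ A ++ c ∷ B             ∎
  where open PermutationReasoning

rows⇒Ladder : ∀ {n} A B → All (_< n) A → Decreasing A → Pointwise _<_ B A → Ladder A B n
rows⇒Ladder [] [] [] [] [] = []
rows⇒Ladder (m ∷ A) (c ∷ B) (m<n ∷ _) (A<m ∷ dA) (c<m ∷ B<A) = rung (rows⇒Ladder A B A<m dA B<A) c<m m<n

Ladder⇒rows : ∀ {A B n} → Ladder A B n → All (_< n) A × Decreasing A × Pointwise _<_ B A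
Ladder⇒rows [] = [] , [] , []
Ladder⇒rows (rung l c<m m<n) =
  let (A<m , dA , B<A) = Ladder⇒rows l in
  m<n ∷ All.map (λ a<m → <-trans a<m m<n) A<m , A<m ∷ dA , c<m ∷ B<A

ladder-injective : ∀ {A B A' B' n} → Ladder A B n → Ladder A' B' n →
  ladder A B n ≡ ladder A' B' n → (A , B) ≡ (A' , B')
ladder-injective [] [] _ = refl
ladder-injective {n = n} [] (rung {A'} {B'} {m'} {c'} _ _ _) eq
  with () ← ++-conicalʳ (ladder A' B' m') [ c' ]
              (sym (proj₁ (∷ʳ-injective [] _ (trans eq (ladder-rung m' A' c' B' n)))))
ladder-injective {n = n} (rung {A} {B} {m} {c} _ _ _) [] eq
  with () ← ++-conicalʳ (ladder A B m) [ c ]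
              (proj₁ (∷ʳ-injective _ [] (trans (sym (ladder-rung m A c B n)) eq)))
ladder-injective {n = n} (rung {A} {B} {m} {c} l _ _) (rung {A'} {B'} {m'} {c'} l' _ _) eq
  with Xc≡X'c' , _ ← ∷ʳ-injective (ladder A B m ∷ʳ c) _
         (trans (sym (ladder-rung m A c B n)) (trans eq (ladder-rung m' A' c' B' n)))
  with X≡X' , refl ← ∷ʳ-injective (ladder A B m) _ Xc≡X'c'
  with refl ← ladder≡⇒top≡ A B A' B' X≡X'
  with refl ← ladder-injective l l' X≡X' = refl

s-ladderPreimage : ∀ {A B n} → Ladder A B n → s (ladderPreimage A B n) ≡ ladder A B n
s-ladderPreimage {n = n} [] = s-[ n ]
s-ladderPreimage {m ∷ A} {c ∷ B} {n} (rung l c<m m<n) = begin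
  s (ladderPreimage A B m ++ n ∷ [ c ])
    ≡⟨ s-split _ n [ c ] pre<n (<⇒≤ (<-trans c<m m<n) ∷ []) ⟩
  s (ladderPreimage A B m) ++ s [ c ] ++ [ n ]
    ≡⟨ cong₂ (λ u v → u ++ v ++ [ n ]) (s-ladderPreimage l) s-[ c ] ⟩
  ladder A B m ++ c ∷ [ n ]
    ∎
  where
  open ≡-Reasoning
  pre<n = All-resp-↭ (↭-sym (ladderPreimage-↭ A B m)) (ladder-< l m<n)

s-ladder-split : ∀ {A B M c} → Ladder A B M → c < M → ∀ L R →
  s L ++ s R ≡ ladder A B M ∷ʳ c → s L ≡ ladder A B M × R ≡ [ c ]
s-ladder-split {A} {B} {M} {c} l c<M L R eq with s R in sR≡ | initLast (s R)
... | _ | [] = ⊥-elim (<⇒≱ c<M (≤-last-s L sL≡ (subst (M ∈_) (sym sL≡) (∈-++⁺ˡ (∈-ladder A B M)))))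
  where sL≡ = trans (sym (++-identityʳ (s L))) eq
... | _ | T ∷ʳ′ z with ∷ʳ-injective (s L ++ T) _ (trans (++-assoc (s L) T [ z ]) eq)
...   | sLT≡ , refl with T | initLast T
...     | _ | [] = trans (sym (++-identityʳ (s L))) sLT≡ , ↭-singleton-inv (subst (R ↭_) sR≡ (↭-sym (s-↭ R)))
...     | _ | T' ∷ʳ′ t = ⊥-elim (<⇒≱ c<M (≤-last-s R sR≡ M∈sR))
  where
  t≡M : t ≡ M
  t≡M = proj₂ (∷ʳ-injective (s L ++ T') _
          (trans (++-assoc (s L) T' [ t ]) (trans sLT≡ (proj₂ (ladder-∷ʳ A B M)))))
  M∈sR : M ∈ s R
  M∈sR = subst (_∈ s R) t≡M (subst (t ∈_) (sym sR≡) (∈-++⁺ˡ (∈-++⁺ʳ T' (here refl))))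

ladderPreimage-unique : ∀ {A B n} → Ladder A B n → ∀ σ → s σ ≡ ladder A B n → σ ≡ ladderPreimage A B n
ladderPreimage-unique {A} {B} {n} _ [] eq
  with () ← ++-conicalʳ (proj₁ (ladder-∷ʳ A B n)) [ n ] (sym (trans eq (proj₂ (ladder-∷ʳ A B n))))
ladderPreimage-unique {n = n} [] (x ∷ w) eq
  with LR≡ , refl ← s-∷ʳ-inv x w {[]} {n} eq =
  trans (splitAtMax x w) (cong₂ (λ L R → L ++ maxEntry (x ∷ w) ∷ R)
    (s≡[]⇒≡[] _ (++-conicalˡ _ _ LR≡)) (s≡[]⇒≡[] _ (++-conicalʳ _ _ LR≡)))
ladderPreimage-unique {m ∷ A} {c ∷ B} {n} (rung l c<m m<n) (x ∷ w) eq
  with LR≡ , refl ← s-∷ʳ-inv x w (trans eq (sym (++-assoc (ladder A B m) [ c ] [ n ])))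
  with sL≡ , R≡ ← s-ladder-split l c<m (leftOfMax x w) (rightOfMax x w) LR≡ =
  trans (splitAtMax x w) (cong₂ (λ L R → L ++ maxEntry (x ∷ w) ∷ R) (ladderPreimage-unique l _ sL≡) R≡)

-- 321 patterns in ladders

Pattern321 : List ℕ → Set
Pattern321 π = ∃ λ x → ∃ λ y → ∃ λ z → (x ∷ y ∷ [ z ]) ⊆ π × y < x × z < y

Avoid321 : List ℕ → Set
Avoid321 π = ¬ Pattern321 π

Avoid321-⊆ : ∀ {P Q} → P ⊆ Q → Avoid321 Q → Avoid321 P
Avoid321-⊆ P⊆Q avoid (x , y , z , xyz⊆P , y<x , z<y) = avoid (x , y , z , ⊆-trans xyz⊆P P⊆Q , y<x , z<y)

from∈³ : ∀ {x y z} {P Q R : List ℕ} → x ∈ P → y ∈ Q → z ∈ R → (x ∷ y ∷ [ z ]) ⊆ P ++ Q ++ R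
from∈³ x∈P y∈Q z∈R = Sublist.++⁺ (from∈ x∈P) (Sublist.++⁺ (from∈ y∈Q) (from∈ z∈R))

order-of-decreasing-triple : ∀ {x y z} → y < x → z < y →
  ∀ i j → (lookup (x ∷ y ∷ [ z ]) i < lookup (x ∷ y ∷ [ z ]) j) ⇔ (j Fin.< i)
order-of-decreasing-triple y<x z<y = order
  where
  order : ∀ i j → _
  order Fin.zero Fin.zero = mk⇔ (λ x<x → ⊥-elim (<-irrefl refl x<x)) λ ()
  order Fin.zero (Fin.suc Fin.zero) = mk⇔ (λ x<y → ⊥-elim (<-asym x<y y<x)) λ ()
  order Fin.zero (Fin.suc (Fin.suc Fin.zero)) = mk⇔ (λ x<z → ⊥-elim (<-asym x<z (<-trans z<y y<x))) λ ()
  order (Fin.suc Fin.zero) Fin.zero = mk⇔ (λ _ → s≤s z≤n) (λ _ → y<x)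
  order (Fin.suc Fin.zero) (Fin.suc Fin.zero) = mk⇔ (λ y<y → ⊥-elim (<-irrefl refl y<y)) λ { (s≤s ()) }
  order (Fin.suc Fin.zero) (Fin.suc (Fin.suc Fin.zero)) = mk⇔ (λ y<z → ⊥-elim (<-asym y<z z<y)) λ { (s≤s ()) }
  order (Fin.suc (Fin.suc Fin.zero)) Fin.zero = mk⇔ (λ _ → s≤s z≤n) (λ _ → <-trans z<y y<x)
  order (Fin.suc (Fin.suc Fin.zero)) (Fin.suc Fin.zero) = mk⇔ (λ _ → s≤s (s≤s z≤n)) (λ _ → z<y)
  order (Fin.suc (Fin.suc Fin.zero)) (Fin.suc (Fin.suc Fin.zero)) =
    mk⇔ (λ z<z → ⊥-elim (<-irrefl refl z<z)) λ { (s≤s (s≤s ())) }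

contains321⇒pattern : ∀ {π} → Contains π (3 ∷ 2 ∷ [ 1 ]) → Pattern321 π
contains321⇒pattern (x ∷ y ∷ z ∷ [] , xyz⊆π , _ , same) =
  x , y , z , xyz⊆π , Equivalence.from (same 1F 0F 1F 0F refl refl) (s≤s (s≤s (s≤s z≤n))) ,
                      Equivalence.from (same 2F 1F 2F 1F refl refl) (s≤s (s≤s z≤n))
  where
  0F 1F 2F : Fin.Fin 3
  0F = Fin.zero
  1F = Fin.suc Fin.zero
  2F = Fin.suc (Fin.suc Fin.zero)
contains321⇒pattern ([] , _ , () , _)
contains321⇒pattern (_ ∷ [] , _ , () , _)
contains321⇒pattern (_ ∷ _ ∷ [] , _ , () , _)
contains321⇒pattern (_ ∷ _ ∷ _ ∷ _ ∷ _ , _ , () , _)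

pattern⇒contains321 : ∀ {π} → Pattern321 π → Contains π (3 ∷ 2 ∷ [ 1 ])
pattern⇒contains321 (x , y , z , xyz⊆π , y<x , z<y) = x ∷ y ∷ [ z ] , xyz⊆π , refl , same
  where
  same : ∀ i j i' j' → Fin.toℕ i ≡ Fin.toℕ i' → Fin.toℕ j ≡ Fin.toℕ j' → _
  same i j i' j' i≡i' j≡j' with refl ← toℕ-injective i≡i' | refl ← toℕ-injective j≡j' =
    ⇔-trans (order-of-decreasing-triple y<x z<y i j)
            (⇔-sym (order-of-decreasing-triple (s≤s (s≤s (s≤s z≤n))) (s≤s (s≤s z≤n)) i j))

ladder-inversion : ∀ {A B n x y} → Ladder A B n → x ∷ [ y ] ⊆ ladder A B n → y < x → y ∈ B
ladder-inversion [] (_ ⊆.∷ʳ ())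
ladder-inversion [] (refl ∷ ())
ladder-inversion {m ∷ A} {c ∷ B} {n} (rung l c<m m<n) p y<x
  with pair-⊆-∷ʳ⁻ (ladder A B m ∷ʳ c) (subst (_ ⊆_) (ladder-rung m A c B n) p)
... | inj₂ (x∈ , refl) = ⊥-elim (<⇒≱ y<x (All.lookup (ladder-≤ (rung l c<m m<n))
                           (subst (_ ∈_) (sym (ladder-rung m A c B n)) (∈-++⁺ˡ x∈))))
... | inj₁ q with pair-⊆-∷ʳ⁻ (ladder A B m) q
...   | inj₁ q' = there (ladder-inversion l q' y<x)
...   | inj₂ (_ , refl) = here refl

bottom⇒inversion : ∀ {A B n b} → Ladder A B n → b ∈ B → ∃ λ x → x ∷ [ b ] ⊆ ladder A B n × b < x
bottom⇒inversion {m ∷ A} {c ∷ B} (rung l c<m m<n) (here refl) =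
  m , Sublist.++⁺ (from∈ (∈-ladder A B m)) (from∈ (here refl)) , c<m
bottom⇒inversion {m ∷ A} {c ∷ B} {n} (rung l c<m m<n) (there b∈B) =
  let (x , xb⊆ , b<x) = bottom⇒inversion l b∈B in x , Sublist.++⁺ʳ (c ∷ [ n ]) xb⊆ , b<x

avoid321⇒bottoms-decreasing : ∀ {A B n} → Ladder A B n → Unique (ladder A B n) → Avoid321 (ladder A B n) →
  Decreasing B
avoid321⇒bottoms-decreasing [] _ _ = []
avoid321⇒bottoms-decreasing {m ∷ A} {c ∷ B} {n} (rung l c<m m<n) u avoid =
  All.tabulate below-c ∷ avoid321⇒bottoms-decreasing l (Unique-⊆ X⊆ u) (Avoid321-⊆ X⊆ avoid)
  where
  X = ladder A B m
  X⊆ = Sublist.++⁺ʳ (c ∷ [ n ]) (⊆-refl {x = X})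
  below-c : ∀ {b} → b ∈ B → c > b
  below-c {b} b∈B with bottom⇒inversion l b∈B
  ... | x , xb⊆X , b<x with <-cmp b c
  ...   | tri< b<c _ _ = b<c
  ...   | tri≈ _ b≡c _ = ⊥-elim (Unique-++⇒≢ X u (⊆.lookup xb⊆X (there (here refl))) (here refl) b≡c)
  ...   | tri> _ _ c<b = ⊥-elim (avoid (x , b , c , Sublist.++⁺ xb⊆X (from∈ (here refl)) , b<x , c<b))

bottoms-decreasing⇒avoid321 : ∀ {A B n} → Ladder A B n → Decreasing B → Avoid321 (ladder A B n)
bottoms-decreasing⇒avoid321 [] _ (_ , _ , _ , p , _) with s≤s () ← Sublist.length-mono-≤ p
bottoms-decreasing⇒avoid321 {m ∷ A} {c ∷ B} {n} (rung l c<m m<n) (c>B ∷ decB) (x , y , z , p , y<x , z<y)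
  with triple-⊆-∷ʳ⁻ (ladder A B m ∷ʳ c) (subst (_ ⊆_) (ladder-rung m A c B n) p)
... | inj₂ (xy⊆ , refl) = <⇒≱ z<y (All.lookup (ladder-≤ (rung l c<m m<n))
        (subst (y ∈_) (sym (ladder-rung m A c B n)) (∈-++⁺ˡ (⊆.lookup xy⊆ (there (here refl))))))
... | inj₁ q with triple-⊆-∷ʳ⁻ (ladder A B m) q
...   | inj₁ q' = bottoms-decreasing⇒avoid321 l decB (x , y , z , q' , y<x , z<y)
...   | inj₂ (xy⊆ , refl) = <-asym z<y (All.lookup c>B (ladder-inversion l xy⊆ y<x))

-- Uniquely sorted 321-avoiding words are ladders

SortsUniquely : List ℕ → Set
SortsUniquely σ = ∀ σ' → s σ' ≡ s σ → σ' ≡ σ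

IsLadder : List ℕ → Set
IsLadder π = Σ[ A ∈ List ℕ ] Σ[ B ∈ List ℕ ] Σ[ n ∈ ℕ ] (π ≡ ladder A B n × Ladder A B n)

ladder-++-preimage : ∀ {A₁ B₁ M₁ A B M} → Ladder A₁ B₁ M₁ → Ladder A B M → M₁ < M →
  Unique (ladder A₁ B₁ M₁ ++ ladder A B M) → Avoid321 (ladder A₁ B₁ M₁ ++ ladder A B M) →
  ∃ λ ρ → s ρ ≡ ladder A₁ B₁ M₁ ++ ladder A B M
ladder-++-preimage {A₁} {B₁} {M₁} {M = M} l₁ [] M₁<M _ _ =
  ladderPreimage A₁ B₁ M₁ ∷ʳ M ,
  trans (s-split _ M [] (All-resp-↭ (↭-sym (ladderPreimage-↭ A₁ B₁ M₁)) (ladder-< l₁ M₁<M)) [])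
        (cong (_∷ʳ M) (s-ladderPreimage l₁))
ladder-++-preimage {A₁} {B₁} {M₁} l₁ (rung {A} {B} {M'} {d} {M} l d<M' M'<M) M₁<M u avoid
  with <-cmp M₁ M'
... | tri< M₁<M' _ _ = ρ ++ M ∷ [ d ] , (begin
  s (ρ ++ M ∷ [ d ])             ≡⟨ s-split ρ M [ d ] ρ<M (<⇒≤ (<-trans d<M' M'<M) ∷ []) ⟩
  s ρ ++ s [ d ] ++ [ M ]         ≡⟨ cong₂ (λ u v → u ++ v ++ [ M ]) sρ≡ s-[ d ] ⟩
  (Y ++ X) ++ d ∷ [ M ]           ≡⟨ ++-assoc Y X (d ∷ [ M ]) ⟩
  Y ++ X ++ d ∷ [ M ]             ∎)
  where
  open ≡-Reasoning
  Y = ladder A₁ B₁ M₁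
  X = ladder A B M'
  YX⊆ : Y ++ X ⊆ Y ++ X ++ d ∷ [ M ]
  YX⊆ = Sublist.++⁺ (⊆-refl {x = Y}) (Sublist.++⁺ʳ (d ∷ [ M ]) (⊆-refl {x = X}))
  IH = ladder-++-preimage l₁ l M₁<M' (Unique-⊆ YX⊆ u) (Avoid321-⊆ YX⊆ avoid)
  ρ = proj₁ IH
  sρ≡ = proj₂ IH
  ρ<M : All (_< M) ρ
  ρ<M = All-s⁻ ρ (subst (All (_< M)) (sym sρ≡) (All.++⁺ (ladder-< l₁ M₁<M) (ladder-< l M'<M)))
... | tri≈ _ M₁≡M' _ =
  ⊥-elim (Unique-++⇒≢ (ladder A₁ B₁ M₁) u (∈-ladder A₁ B₁ M₁) (∈-++⁺ˡ (∈-ladder A B M')) M₁≡M')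
... | tri> _ _ M'<M₁ =
  ⊥-elim (avoid (M₁ , M' , d , from∈³ (∈-ladder A₁ B₁ M₁) (∈-ladder A B M') (here refl) , M'<M₁ , d<M'))

SortsUniquely-left : ∀ L m R → All (_< m) L → All (_≤ m) R → SortsUniquely (L ++ m ∷ R) → SortsUniquely L
SortsUniquely-left L m R L<m R≤m unique L' sL'≡sL = ++-cancelʳ (m ∷ R) L' L (unique (L' ++ m ∷ R) (begin
  s (L' ++ m ∷ R)      ≡⟨ s-split L' m R L'<m R≤m ⟩
  s L' ++ s R ++ [ m ] ≡⟨ cong (_++ s R ++ [ m ]) sL'≡sL ⟩
  s L ++ s R ++ [ m ]  ≡⟨ s-split L m R L<m R≤m ⟨
  s (L ++ m ∷ R)       ∎))
  where
  open ≡-Reasoning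
  L'<m = All-s⁻ L' (subst (All (_< m)) (sym sL'≡sL) (All-s⁺ L L<m))

SortsUniquely-right : ∀ L m R → All (_< m) L → All (_≤ m) R → SortsUniquely (L ++ m ∷ R) → SortsUniquely R
SortsUniquely-right L m R L<m R≤m unique R' sR'≡sR = ∷-injectiveʳ (++-cancelˡ L _ _ (unique (L ++ m ∷ R') (begin
  s (L ++ m ∷ R')      ≡⟨ s-split L m R' L<m R'≤m ⟩
  s L ++ s R' ++ [ m ] ≡⟨ cong (λ v → s L ++ v ++ [ m ]) sR'≡sR ⟩
  s L ++ s R ++ [ m ]  ≡⟨ s-split L m R L<m R≤m ⟨
  s (L ++ m ∷ R)       ∎)))
  where
  open ≡-Reasoning
  R'≤m = All-s⁻ R' (subst (All (_≤ m)) (sym sR'≡sR) (All-s⁺ R R≤m))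

-- Both τ m and m τ sort to π m, so a unique preimage of π m leaves no preimage for π ≢ [].
init-of-sorted-no-preimage : ∀ σ {π m} → s σ ≡ π ∷ʳ m → All (_< m) π → SortsUniquely σ →
  ∀ τ → s τ ≡ π → π ≡ []
init-of-sorted-no-preimage σ {π} {m} sσ≡ π<m unique τ sτ≡π = τm≡mτ⇒π≡[] τ sτ≡π τ<m (trans τm≡σ (sym mτ≡σ))
  where
  τ<m = All-s⁻ τ (subst (All (_< m)) (sym sτ≡π) π<m)
  τm≡σ = unique (τ ∷ʳ m) (trans (s-split τ m [] τ<m []) (trans (cong (_∷ʳ m) sτ≡π) (sym sσ≡)))
  mτ≡σ = unique (m ∷ τ) (trans (s-split [] m τ [] (All.map <⇒≤ τ<m)) (trans (cong (_∷ʳ m) sτ≡π) (sym sσ≡)))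
  τm≡mτ⇒π≡[] : ∀ τ → s τ ≡ π → All (_< m) τ → τ ∷ʳ m ≡ m ∷ τ → π ≡ []
  τm≡mτ⇒π≡[] [] sτ≡π _ _ = sym sτ≡π
  τm≡mτ⇒π≡[] (t ∷ τ) _ (t<m ∷ _) tτm≡mtτ = ⊥-elim (<-irrefl (∷-injectiveˡ tτm≡mtτ) t<m)

join-ladders : ∀ {Y Z m} → IsLadder Y → IsLadder Z → Unique (Y ++ Z) → Avoid321 (Y ++ Z) →
  All (_< m) (Y ++ Z) → (∀ τ → s τ ≢ Y ++ Z) → IsLadder (Y ++ Z ++ [ m ])
join-ladders {m = m} (A₁ , B₁ , M₁ , refl , l₁) (A₂ , B₂ , M₂ , refl , l₂) u avoid YZ<m noPreimage
  with <-cmp M₁ M₂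
... | tri< M₁<M₂ _ _ = ⊥-elim (uncurry noPreimage (ladder-++-preimage l₁ l₂ M₁<M₂ u avoid))
... | tri≈ _ M₁≡M₂ _ = ⊥-elim (Unique-++⇒≢ (ladder A₁ B₁ M₁) u (∈-ladder A₁ B₁ M₁) (∈-ladder A₂ B₂ M₂) M₁≡M₂)
... | tri> _ _ M₂<M₁ with l₂
...   | [] = M₁ ∷ A₁ , M₂ ∷ B₁ , m , refl , rung l₁ M₂<M₁ (All.lookup YZ<m (∈-++⁺ˡ (∈-ladder A₁ B₁ M₁)))
...   | rung {A} {B} {M'} {d} _ d<M' M'<M₂ = ⊥-elim (avoid (M₁ , M' , d ,
          from∈³ (∈-ladder A₁ B₁ M₁) (∈-ladder A B M') (here refl) , <-trans M'<M₂ M₂<M₁ , d<M'))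

sortedParts-< : ∀ L m R → All (_< m) L → All (_≤ m) R → Unique (s L ++ s R ++ [ m ]) → All (_< m) (s L ++ s R)
sortedParts-< L m R L<m R≤m u = Unique-∷ʳ⇒< (subst Unique (sym (++-assoc (s L) (s R) [ m ])) u)
  (All.++⁺ (All-s⁺ L (All.map <⇒≤ L<m)) (All-s⁺ R R≤m))

sortedParts-no-preimage : ∀ L m R → All (_< m) L → All (_≤ m) R → Unique (s L ++ s R ++ [ m ]) →
  SortsUniquely (L ++ m ∷ R) → ∀ τ → s τ ≡ s L ++ s R → s L ++ s R ≡ []
sortedParts-no-preimage L m R L<m R≤m u =
  init-of-sorted-no-preimage (L ++ m ∷ R) (trans (s-split L m R L<m R≤m) (sym (++-assoc (s L) (s R) [ m ])))
    (sortedParts-< L m R L<m R≤m u)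

mutual
  sortsUniquely⇒ladder : ∀ f x w → length w ≤ f →
    Unique (s (x ∷ w)) → Avoid321 (s (x ∷ w)) → SortsUniquely (x ∷ w) → IsLadder (s (x ∷ w))
  sortsUniquely⇒ladder f x w w≤f u avoid unique =
    subst IsLadder (sym (s-unfold x w)) (ladder-at-max f L m R
      (≤-trans (length-leftOfMax x w) w≤f) (≤-trans (length-rightOfMax x w) w≤f)
      (leftOfMax-< x w) (rightOfMax-≤ x w)
      (subst Unique (s-unfold x w) u) (subst Avoid321 (s-unfold x w) avoid)
      (subst SortsUniquely (splitAtMax x w) unique))
    where
    L = leftOfMax x w
    R = rightOfMax x w
    m = maxEntry (x ∷ w)

  ladder-at-max : ∀ f L m R → length L ≤ f → length R ≤ f → All (_< m) L → All (_≤ m) R →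
    Unique (s L ++ s R ++ [ m ]) → Avoid321 (s L ++ s R ++ [ m ]) → SortsUniquely (L ++ m ∷ R) →
    IsLadder (s L ++ s R ++ [ m ])
  ladder-at-max f [] m [] _ _ _ _ _ _ _ = [] , [] , m , refl , []
  ladder-at-max f [] m (r ∷ R) _ _ L<m R≤m u _ unique
    with () ← s≡[]⇒≡[] (r ∷ R) (sortedParts-no-preimage [] m (r ∷ R) L<m R≤m u unique (r ∷ R) refl)
  ladder-at-max f (l ∷ L) m [] _ _ L<m R≤m u _ unique
    with () ← s≡[]⇒≡[] (l ∷ L) (trans (sym (++-identityʳ _))
                (sortedParts-no-preimage (l ∷ L) m [] L<m R≤m u unique (l ∷ L) (sym (++-identityʳ _))))
  ladder-at-max (suc f) (l ∷ L) m (r ∷ R) (s≤s L≤f) (s≤s R≤f) L<m R≤m u avoid unique =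
    join-ladders
      (sortsUniquely⇒ladder f l L L≤f (Unique-⊆ sL⊆ u) (Avoid321-⊆ sL⊆ avoid)
        (SortsUniquely-left (l ∷ L) m (r ∷ R) L<m R≤m unique))
      (sortsUniquely⇒ladder f r R R≤f (Unique-⊆ sR⊆ u) (Avoid321-⊆ sR⊆ avoid)
        (SortsUniquely-right (l ∷ L) m (r ∷ R) L<m R≤m unique))
      (Unique-⊆ π⊆ u) (Avoid321-⊆ π⊆ avoid)
      (sortedParts-< (l ∷ L) m (r ∷ R) L<m R≤m u)
      (λ τ sτ≡π → sL≢[] (++-conicalˡ _ _ (sortedParts-no-preimage (l ∷ L) m (r ∷ R) L<m R≤m u unique τ sτ≡π)))
    where
    sL⊆ = Sublist.++⁺ʳ (s (r ∷ R) ++ [ m ]) (⊆-refl {x = s (l ∷ L)})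
    sR⊆ = Sublist.++⁺ˡ (s (l ∷ L)) (Sublist.++⁺ʳ [ m ] (⊆-refl {x = s (r ∷ R)}))
    π⊆ = Sublist.++⁺ (⊆-refl {x = s (l ∷ L)}) (Sublist.++⁺ʳ [ m ] (⊆-refl {x = s (r ∷ R)}))
    sL≢[] : s (l ∷ L) ≢ []
    sL≢[] sL≡[] with () ← s≡[]⇒≡[] (l ∷ L) sL≡[]

-- Ballot numbers

ballot : ℕ → ℕ → ℕ
ballot zero zero = 1
ballot zero (suc q) = 0
ballot (suc p) zero = ballot p zero
ballot (suc p) (suc q) with q ≤? p
... | yes _ = ballot p (suc q) + ballot (suc p) q
... | no _ = 0

ballot-zero : ∀ p → ballot p 0 ≡ 1
ballot-zero zero = refl
ballot-zero (suc p) = ballot-zero p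

ballot-> : ∀ p q → p < q → ballot p q ≡ 0
ballot-> zero (suc q) _ = refl
ballot-> (suc p) (suc q) (s≤s p<q) with q ≤? p
... | yes q≤p = ⊥-elim (<⇒≱ p<q q≤p)
... | no _ = refl

ballot-suc : ∀ p q → q ≤ p → ballot (suc p) (suc q) ≡ ballot p (suc q) + ballot (suc p) q
ballot-suc p q q≤p with q ≤? p
... | yes _ = refl
... | no q≰p = ⊥-elim (q≰p q≤p)

_C⁻_ : ℕ → ℕ → ℕ
n C⁻ zero = 0
n C⁻ suc q = n C q

pascal⁻ : ∀ n q → suc n C q ≡ n C⁻ q + n C q
pascal⁻ n zero = refl
pascal⁻ n (suc q) = sym (nCk+nC[k+1]≡[n+1]C[k+1] n q)

-- The count given by André's reflection principle.
ballot-reflection : ∀ p q → q ≤ p → ballot p q + (p + q) C⁻ q ≡ (p + q) C q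
ballot-reflection p zero _ rewrite ballot-zero p = refl
ballot-reflection (suc p) (suc q) (s≤s q≤p) = begin
  ballot (suc p) (suc q) + suc N C q                        ≡⟨ cong₂ _+_ (ballot-suc p q q≤p) (pascal⁻ N q) ⟩
  (ballot p (suc q) + ballot (suc p) q) + (N C⁻ q + N C q)  ≡⟨ shuffle (ballot p (suc q)) _ (N C⁻ q) _ ⟩
  (ballot p (suc q) + N C q) + (ballot (suc p) q + N C⁻ q)  ≡⟨ cong₂ _+_ upper lower ⟩
  N C suc q + N C q                                         ≡⟨ +-comm (N C suc q) (N C q) ⟩
  N C q + N C suc q                                         ≡⟨ nCk+nC[k+1]≡[n+1]C[k+1] N q ⟩
  suc N C suc q                                             ∎
  where
  open ≡-Reasoning
  N = p + suc q
  shuffle : ∀ a b c d → (a + b) + (c + d) ≡ (a + d) + (b + c)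
  shuffle = solve-∀
  upper : ballot p (suc q) + N C q ≡ N C suc q
  upper with m≤n⇒m<n∨m≡n q≤p
  ... | inj₁ q<p = ballot-reflection p (suc q) q<p
  ... | inj₂ refl rewrite ballot-> q (suc q) ≤-refl =
    trans (nCk≡nC[n∸k] (m≤m+n q (suc q))) (cong (N C_) (m+n∸m≡n q (suc q)))
  lower : ballot (suc p) q + N C⁻ q ≡ N C q
  lower = subst (λ M → ballot (suc p) q + M C⁻ q ≡ M C q) (sym (+-suc p q))
            (ballot-reflection (suc p) q (m≤n⇒m≤1+n q≤p))

C-ratio : ∀ n j → (n C j) * (n ∸ j) ≡ (n C suc j) * suc j
C-ratio zero zero = refl
C-ratio zero (suc j) = refl
C-ratio (suc n) zero rewrite nC1≡n (suc n) = *-comm 1 (suc n)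
C-ratio (suc n) (suc j) = begin
  (suc n C suc j) * (n ∸ j)              ≡⟨ cong (_* (n ∸ j)) (pascal⁻ n (suc j)) ⟩
  (c₀ + c₁) * (n ∸ j)                    ≡⟨ *-distribʳ-+ (n ∸ j) c₀ c₁ ⟩
  c₀ * (n ∸ j) + c₁ * (n ∸ j)            ≡⟨ cong (_+ c₁ * (n ∸ j)) (C-ratio n j) ⟩
  c₁ * suc j + c₁ * (n ∸ j)              ≡⟨ shift-one ⟩
  c₁ * suc (suc j) + c₁ * (n ∸ suc j)    ≡⟨ cong (c₁ * suc (suc j) +_) (C-ratio n (suc j)) ⟩
  c₁ * suc (suc j) + c₂ * suc (suc j)    ≡⟨ *-distribʳ-+ (suc (suc j)) c₁ c₂ ⟨
  (c₁ + c₂) * suc (suc j)                ≡⟨ cong (_* suc (suc j)) (pascal⁻ n (suc (suc j))) ⟨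
  (suc n C suc (suc j)) * suc (suc j)    ∎
  where
  open ≡-Reasoning
  c₀ = n C j
  c₁ = n C suc j
  c₂ = n C suc (suc j)
  shift-one : c₁ * suc j + c₁ * (n ∸ j) ≡ c₁ * suc (suc j) + c₁ * (n ∸ suc j)
  shift-one with suc j ≤? n
  ... | yes j<n rewrite +-∸-assoc 1 j<n = move-one c₁ j (n ∸ suc j)
    where
    move-one : ∀ b j x → b * suc j + b * suc x ≡ b * suc (suc j) + b * x
    move-one = solve-∀
  ... | no j≮n rewrite k>n⇒nCk≡0 (≰⇒> j≮n) = refl

catalan≡ballot : ∀ k → catalan k ≡ ballot k k
catalan≡ballot zero = refl
catalan≡ballot k@(suc j) = begin
  ((2 * k) C k) / suc k        ≡⟨ cong (λ n → (n C k) / suc k) (cong (k +_) (+-identityʳ k)) ⟩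
  C₀ / suc k                   ≡⟨ cong (_/ suc k) ballot*[k+1]≡C₀ ⟨
  ballot k k * suc k / suc k   ≡⟨ m*n/n≡m (ballot k k) (suc k) ⟩
  ballot k k                   ∎
  where
  open ≡-Reasoning
  C₀ = (k + k) C k
  C₁ = (k + k) C j
  C₁*[k+1]≡C₀*k : C₁ * suc k ≡ C₀ * k
  C₁*[k+1]≡C₀*k = subst (λ x → C₁ * x ≡ C₀ * k) (trans (cong (λ x → suc x ∸ j) (+-suc j j)) (m+n∸n≡m (suc k) j))
                    (C-ratio (k + k) j)
  ballot*[k+1]≡C₀ : ballot k k * suc k ≡ C₀
  ballot*[k+1]≡C₀ = +-cancelʳ-≡ (C₀ * k) _ _ (begin
    ballot k k * suc k + C₀ * k       ≡⟨ cong (ballot k k * suc k +_) C₁*[k+1]≡C₀*k ⟨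
    ballot k k * suc k + C₁ * suc k   ≡⟨ *-distribʳ-+ (suc k) (ballot k k) C₁ ⟨
    (ballot k k + C₁) * suc k         ≡⟨ cong (_* suc k) (ballot-reflection k k ≤-refl) ⟩
    C₀ * suc k                        ≡⟨ *-suc C₀ k ⟩
    C₀ + C₀ * k                       ∎)

-- Standard Young tableaux with two rows

range-∷ʳ : ∀ n → range (suc n) ≡ range n ∷ʳ suc n
range-∷ʳ n = trans (cong (map suc) (sym (upTo-∷ʳ n))) (map-++ suc (upTo n) [ n ])

∈-range⇒≤ : ∀ n {v} → v ∈ range n → v ≤ n
∈-range⇒≤ (suc n) {v} v∈ with ∈-++⁻ (range n) (subst (v ∈_) (range-∷ʳ n) v∈)
... | inj₁ v∈range = m≤n⇒m≤1+n (∈-range⇒≤ n v∈range)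
... | inj₂ (here refl) = ≤-refl

max∈range : ∀ n → suc n ∈ range (suc n)
max∈range n = subst (suc n ∈_) (sym (range-∷ʳ n)) (∈-++⁺ʳ (range n) (here refl))

length-range : ∀ n → length (range n) ≡ n
length-range n = trans (length-map suc (upTo n)) (length-upTo n)

Unique-range : ∀ n → Unique (range n)
Unique-range n = Unique.map⁺ suc-injective (Unique.upTo⁺ n)

↭-range⇒< : ∀ {xs n} → xs ↭ range n → All (_< suc n) xs
↭-range⇒< {n = n} xs↭ = All.tabulate (λ x∈xs → s≤s (∈-range⇒≤ n (∈-resp-↭ xs↭ x∈xs)))

range-suc-↭ : ∀ {xs n} → xs ↭ range n → suc n ∷ xs ↭ range (suc n)
range-suc-↭ {xs} {n} xs↭ =
  ↭-trans (prep (suc n) xs↭) (↭-trans (∷↭∷ʳ (suc n) (range n)) (↭-reflexive (sym (range-∷ʳ n))))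

range-suc-↭⁻ : ∀ {xs n} → suc n ∷ xs ↭ range (suc n) → xs ↭ range n
range-suc-↭⁻ {xs} {n} ↭range =
  ↭-trans (drop-mid [] (range n) {xs} {[]} (subst (suc n ∷ xs ↭_) (range-∷ʳ n) ↭range))
          (↭-reflexive (++-identityʳ (range n)))

-- The rows of a standard Young tableau of shape (p, q) with entries 1, …, p + q, each listed in
-- decreasing order; the column condition compares A with the last q entries of B.
record Tableau (p q : ℕ) (A B : List ℕ) : Set where
  constructor tableau
  field
    q≤p          : q ≤ p
    length-A     : length A ≡ q
    length-B     : length B ≡ p
    decreasing-A : Decreasing A
    decreasing-B : Decreasing B
    columns      : Pointwise _<_ (drop (p ∸ q) B) A
    entries      : A ++ B ↭ range (p + q)

extendB : ∀ {p q A B} → Tableau p q A B → Tableau (suc p) q A (suc (p + q) ∷ B)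
extendB {p} {q} {A} {B} (tableau q≤p lA lB dA dB cols ents) = tableau
  (m≤n⇒m≤1+n q≤p) lA (cong suc lB) dA (All.++⁻ʳ A (↭-range⇒< ents) ∷ dB)
  (subst (λ B' → Pointwise _<_ B' A) (sym (drop-suc∸ _ B q≤p)) cols)
  (↭-trans (shift (suc (p + q)) A B) (range-suc-↭ ents))

shrinkB : ∀ {p q A B} → Tableau (suc p) q A (suc (p + q) ∷ B) → q ≤ p → Tableau p q A B
shrinkB {p} {q} {A} {B} (tableau _ lA lB dA (_ ∷ dB) cols ents) q≤p = tableau
  q≤p lA (suc-injective lB) dA dB
  (subst (λ B' → Pointwise _<_ B' A) (drop-suc∸ _ B q≤p) cols)
  (range-suc-↭⁻ (↭-trans (↭-sym (shift (suc (p + q)) A B)) ents))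

extendA : ∀ {p q A B} → Tableau (suc p) q A B → q ≤ p → Tableau (suc p) (suc q) (suc p + suc q ∷ A) B
extendA {p} {q} {A} {B} (tableau _ lA lB dA dB cols ents) q≤p = tableau
  (s≤s q≤p) (cong suc lA) lB (subst (λ n → All (_< n) A) top≡ (All.++⁻ˡ A (↭-range⇒< ents)) ∷ dA) dB
  cols' (subst (λ n → n ∷ A ++ B ↭ range n) top≡ (range-suc-↭ ents))
  where
  top≡ = sym (+-suc (suc p) q)
  B<top = subst (λ n → All (_< n) B) top≡ (All.++⁻ʳ A (↭-range⇒< ents))
  cols' : Pointwise _<_ (drop (p ∸ q) B) (suc p + suc q ∷ A)
  cols' with b , b∈B , drop≡ ← drop-∷ (p ∸ q) B (subst (p ∸ q <_) (sym lB) (s≤s (m∸n≤m p q)))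
    rewrite drop≡ = All.lookup B<top b∈B ∷ subst (λ d → Pointwise _<_ (drop d B) A) (+-∸-assoc 1 q≤p) cols

shrinkA : ∀ {p q A B} → Tableau (suc p) (suc q) (suc p + suc q ∷ A) B → Tableau (suc p) q A B
shrinkA {p} {q} {A} {B} (tableau (s≤s q≤p) lA lB (_ ∷ dA) dB cols ents) = tableau
  (m≤n⇒m≤1+n q≤p) (suc-injective lA) lB dA dB
  (subst (λ d → Pointwise _<_ (drop d B) A) (sym (+-∸-assoc 1 q≤p)) (Pointwise-drop⁻ (p ∸ q) B cols))
  (range-suc-↭⁻ (subst (λ n → n ∷ A ++ B ↭ range n) (+-suc (suc p) q) ents))

tableaux : ℕ → ℕ → List (List ℕ × List ℕ)
tableaux zero zero = [ ([] , []) ]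
tableaux zero (suc q) = []
tableaux (suc p) zero = map (map₂ (suc p + zero ∷_)) (tableaux p zero)
tableaux (suc p) (suc q) with q ≤? p
... | yes _ = map (map₂ (suc p + suc q ∷_)) (tableaux p (suc q))
           ++ map (map₁ (suc p + suc q ∷_)) (tableaux (suc p) q)
... | no _ = []

length-tableaux : ∀ p q → length (tableaux p q) ≡ ballot p q
length-tableaux zero zero = refl
length-tableaux zero (suc q) = refl
length-tableaux (suc p) zero = trans (length-map _ (tableaux p zero)) (length-tableaux p zero)
length-tableaux (suc p) (suc q) with q ≤? p
... | yes _ = trans (length-++ (map (map₂ (suc p + suc q ∷_)) (tableaux p (suc q))))
    (cong₂ _+_ (trans (length-map _ (tableaux p (suc q))) (length-tableaux p (suc q)))
               (trans (length-map _ (tableaux (suc p) q)) (length-tableaux (suc p) q)))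
... | no _ = refl

tableaux-sound : ∀ p q {A B} → (A , B) ∈ tableaux p q → Tableau p q A B
tableaux-sound zero zero (here refl) = tableau z≤n refl refl [] [] [] ↭-refl
tableaux-sound (suc p) zero AB∈ with (A , B) , AB∈' , refl ← ∈-map⁻ (map₂ (suc p + zero ∷_)) AB∈ =
  extendB (tableaux-sound p zero AB∈')
tableaux-sound (suc p) (suc q) AB∈ with q ≤? p
... | yes q≤p with ∈-++⁻ (map (map₂ (suc p + suc q ∷_)) (tableaux p (suc q))) AB∈
...   | inj₁ AB∈B with (A , B) , AB∈' , refl ← ∈-map⁻ (map₂ (suc p + suc q ∷_)) AB∈B =
  extendB (tableaux-sound p (suc q) AB∈')
...   | inj₂ AB∈A with (A , B) , AB∈' , refl ← ∈-map⁻ (map₁ (suc p + suc q ∷_)) AB∈A =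
  extendA (tableaux-sound (suc p) q AB∈') q≤p

head-max : ∀ {b m B} → Decreasing (b ∷ B) → m ∈ b ∷ B → b ≤ m → b ≡ m
head-max _ (here refl) _ = refl
head-max (m<b ∷ _) (there m∈B) b≤m = ⊥-elim (<⇒≱ (All.lookup m<b m∈B) b≤m)

tableaux-complete : ∀ p q {A B} → Tableau p q A B → (A , B) ∈ tableaux p q
tableaux-complete zero zero {[]} {[]} _ = here refl
tableaux-complete zero zero {[]} {_ ∷ _} (tableau _ _ () _ _ _ _)
tableaux-complete zero zero {_ ∷ _} (tableau _ () _ _ _ _ _)
tableaux-complete zero (suc q) (tableau () _ _ _ _ _ _)
tableaux-complete (suc p) zero {_ ∷ _} (tableau _ () _ _ _ _ _)
tableaux-complete (suc p) zero {[]} {[]} (tableau _ _ () _ _ _ _)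
tableaux-complete (suc p) zero {[]} {b ∷ B} t@(tableau _ _ _ _ dB _ ents)
  with refl ← head-max dB (∈-resp-↭ (↭-sym ents) (max∈range (p + zero)))
                          (∈-range⇒≤ _ (∈-resp-↭ ents (here refl))) =
  ∈-map⁺ (map₂ (suc p + zero ∷_)) (tableaux-complete p zero (shrinkB t z≤n))
tableaux-complete (suc p) (suc q) {A} (tableau (s≤s q≤p) _ _ _ _ _ ents) with q ≤? p
... | no q≰p = ⊥-elim (q≰p q≤p)
... | yes _ with ∈-++⁻ A (∈-resp-↭ (↭-sym ents) (max∈range (p + suc q)))
tableaux-complete (suc p) (suc q) {[]} t | yes _ | inj₁ ()
tableaux-complete (suc p) (suc q) {a ∷ A} t@(tableau _ _ _ dA _ _ ents) | yes _ | inj₁ top∈A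
  with refl ← head-max dA top∈A (∈-range⇒≤ _ (∈-resp-↭ ents (here refl))) =
  ∈-++⁺ʳ _ (∈-map⁺ (map₁ (suc p + suc q ∷_)) (tableaux-complete (suc p) q (shrinkA t)))
tableaux-complete (suc p) (suc q) {A} {[]} t | yes _ | inj₂ ()
tableaux-complete (suc p) (suc q) {A} {b ∷ B} t@(tableau (s≤s q≤p) _ _ _ dB cols ents) | yes _ | inj₂ top∈B
  with refl ← head-max dB top∈B (∈-range⇒≤ _ (∈-resp-↭ ents (∈-++⁺ʳ A (here refl))))
  with m≤n⇒m<n∨m≡n q≤p
... | inj₁ q<p = ∈-++⁺ˡ (∈-map⁺ (map₂ (suc p + suc q ∷_)) (tableaux-complete p (suc q) (shrinkB t q<p)))
... | inj₂ refl = ⊥-elim (top-not-in-first-column A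
      (subst (λ d → Pointwise _<_ (drop d (b ∷ B)) A) (n∸n≡0 q) cols)
      (All.tabulate λ a∈A → ∈-range⇒≤ _ (∈-resp-↭ ents (∈-++⁺ˡ a∈A))))
  where
  top-not-in-first-column : ∀ A → Pointwise _<_ (b ∷ B) A → All (_≤ b) A → ⊥
  top-not-in-first-column [] ()
  top-not-in-first-column (a ∷ A) (b<a ∷ _) (a≤b ∷ _) = <⇒≱ b<a a≤b

map₁-∷-injective : ∀ {m : ℕ} {x y : List ℕ × List ℕ} → map₁ (m ∷_) x ≡ map₁ (m ∷_) y → x ≡ y
map₁-∷-injective {x = _ , _} {_ , _} refl = refl

map₂-∷-injective : ∀ {m : ℕ} {x y : List ℕ × List ℕ} → map₂ (m ∷_) x ≡ map₂ (m ∷_) y → x ≡ y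
map₂-∷-injective {x = _ , _} {_ , _} refl = refl

Unique-tableaux : ∀ p q → Unique (tableaux p q)
Unique-tableaux zero zero = [] ∷ []
Unique-tableaux zero (suc q) = []
Unique-tableaux (suc p) zero = Unique.map⁺ map₂-∷-injective (Unique-tableaux p zero)
Unique-tableaux (suc p) (suc q) with q ≤? p
... | no _ = []
... | yes _ = Unique.++⁺ (Unique.map⁺ map₂-∷-injective (Unique-tableaux p (suc q)))
                         (Unique.map⁺ map₁-∷-injective (Unique-tableaux (suc p) q)) disjoint
  where
  top = suc p + suc q
  disjoint : ∀ {v} → ¬ (v ∈ map (map₂ (top ∷_)) (tableaux p (suc q)) ×
                        v ∈ map (map₁ (top ∷_)) (tableaux (suc p) q))
  disjoint (v∈B , v∈A) with (A , B) , AB∈ , refl ← ∈-map⁻ (map₂ (top ∷_)) v∈B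
                       | (A' , B') , _ , eq ← ∈-map⁻ (map₁ (top ∷_)) v∈A =
    <-irrefl refl (All.lookup (All.++⁻ˡ A (↭-range⇒< (Tableau.entries (tableaux-sound p (suc q) AB∈))))
                              (subst (top ∈_) (sym (cong proj₁ eq)) (here refl)))

tableau⇒Ladder : ∀ {k A B} → Tableau k k A B → Ladder A B (suc (k + k))
tableau⇒Ladder {k} {A} {B} (tableau _ _ _ dA _ cols ents) =
  rows⇒Ladder A B (All.++⁻ˡ A (↭-range⇒< ents)) dA (subst (λ d → Pointwise _<_ (drop d B) A) (n∸n≡0 k) cols)

ladder-range⇒tableau : ∀ k {A B n} → Ladder A B n → Decreasing B → ladder A B n ↭ range (suc (k + k)) →
  n ≡ suc (k + k) × Tableau k k A B
ladder-range⇒tableau k {A} {B} {n} l dB ladder↭ =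
  n≡top ,
  tableau ≤-refl length-A length-B dA dB (subst (λ d → Pointwise _<_ (drop d B) A) (sym (n∸n≡0 k)) B<A) AB↭
  where
  n≡top : n ≡ suc (k + k)
  n≡top = ≤-antisym (∈-range⇒≤ _ (∈-resp-↭ ladder↭ (∈-ladder A B n)))
                    (All.lookup (ladder-≤ l) (∈-resp-↭ (↭-sym ladder↭) (max∈range (k + k))))
  dA = proj₁ (proj₂ (Ladder⇒rows l))
  B<A = proj₂ (proj₂ (Ladder⇒rows l))
  AB↭ : A ++ B ↭ range (k + k)
  AB↭ = range-suc-↭⁻ (subst (λ m → m ∷ A ++ B ↭ _) n≡top (↭-trans (↭-sym (ladder-↭ l)) ladder↭))
  length-A : length A ≡ k
  length-A = m+m≡n+n⇒m≡n (begin
    length A + length A ≡⟨ cong (length A +_) (sym (Pointwise-length B<A)) ⟩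
    length A + length B ≡⟨ length-++ A ⟨
    length (A ++ B)     ≡⟨ ↭-length AB↭ ⟩
    length (range (k + k)) ≡⟨ length-range (k + k) ⟩
    k + k               ∎)
    where open ≡-Reasoning
  length-B : length B ≡ k
  length-B = trans (Pointwise-length B<A) length-A

tableau⇒InU : ∀ {k A B} → Tableau k k A B → InU (suc (k + k)) (3 ∷ 2 ∷ [ 1 ]) (ladder A B (suc (k + k)))
tableau⇒InU {k} {A} {B} t@(tableau _ _ _ _ dB _ ents) =
  perm ,
  (ladderPreimage A B N , (↭-trans (ladderPreimage-↭ A B N) perm , s-ladderPreimage l) ,
   λ σ' _ sσ'≡ → ladderPreimage-unique l σ' sσ'≡) ,
  λ contains → bottoms-decreasing⇒avoid321 l dB (contains321⇒pattern contains)
  where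
  N = suc (k + k)
  l = tableau⇒Ladder t
  perm = ↭-trans (ladder-↭ l) (range-suc-↭ ents)

InU⇒tableau : ∀ k π → InU (suc (k + k)) (3 ∷ 2 ∷ [ 1 ]) π →
  ∃₂ λ A B → π ≡ ladder A B (suc (k + k)) × Tableau k k A B
InU⇒tableau k π (perm , ([] , ([]↭ , _) , _) , _) with () ← trans (↭-length []↭) (length-range (suc (k + k)))
InU⇒tableau k π (perm , (x ∷ w , (σ↭ , sσ≡π) , unique) , avoids) =
  from-ladder (sortsUniquely⇒ladder (length w) x w ≤-refl
                 (subst Unique (sym sσ≡π) uπ) (subst Avoid321 (sym sσ≡π) avoidπ) sortsUniquely)
  where
  N = suc (k + k)
  uπ : Unique π
  uπ = Unique-resp-↭ (↭⇒↭ₛ (↭-sym perm)) (Unique-range N)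
  avoidπ : Avoid321 π
  avoidπ p = avoids (pattern⇒contains321 p)
  sortsUniquely : SortsUniquely (x ∷ w)
  sortsUniquely σ' sσ'≡ = unique σ' (↭-trans (↭-sym (s-↭ σ')) (subst (_↭ range N) (sym (trans sσ'≡ sσ≡π)) perm))
                                    (trans sσ'≡ sσ≡π)
  from-ladder : IsLadder (s (x ∷ w)) → ∃₂ λ A B → π ≡ ladder A B N × Tableau k k A B
  from-ladder (A , B , n , sσ≡ladder , l) =
    A , B , trans π≡ (cong (ladder A B) (proj₁ range-tableau)) , proj₂ range-tableau
    where
    π≡ : π ≡ ladder A B n
    π≡ = trans (sym sσ≡π) sσ≡ladder
    range-tableau = ladder-range⇒tableau k l
      (avoid321⇒bottoms-decreasing l (subst Unique π≡ uπ) (subst Avoid321 π≡ avoidπ))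
      (subst (_↭ range N) π≡ perm)

theorem9p1 : (k : ℕ) → HasCard (InU (suc (2 * k)) (3 ∷ 2 ∷ 1 ∷ [])) (catalan k)
theorem9p1 k =
  subst (λ m → HasCard (InU (suc m) (3 ∷ 2 ∷ 1 ∷ [])) (catalan k)) (cong (k +_) (sym (+-identityʳ k)))
  (map toLadder (tableaux k k) , unique , length≡ , λ π → mk⇔ (sound π) (complete π))
  where
  toLadder : List ℕ × List ℕ → List ℕ
  toLadder (A , B) = ladder A B (suc (k + k))
  unique : Unique (map toLadder (tableaux k k))
  unique = Unique-map⁺-on toLadder
    (λ AB∈ AB'∈ → ladder-injective (tableau⇒Ladder (tableaux-sound k k AB∈))
                                   (tableau⇒Ladder (tableaux-sound k k AB'∈)))
    (Unique-tableaux k k)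
  length≡ : length (map toLadder (tableaux k k)) ≡ catalan k
  length≡ = trans (length-map toLadder (tableaux k k)) (trans (length-tableaux k k) (sym (catalan≡ballot k)))
  sound : ∀ π → π ∈ map toLadder (tableaux k k) → InU (suc (k + k)) (3 ∷ 2 ∷ [ 1 ]) π
  sound π π∈ with (A , B) , AB∈ , refl ← ∈-map⁻ toLadder π∈ = tableau⇒InU (tableaux-sound k k AB∈)
  complete : ∀ π → InU (suc (k + k)) (3 ∷ 2 ∷ [ 1 ]) π → π ∈ map toLadder (tableaux k k)
  complete π π∈U with A , B , refl , t ← InU⇒tableau k π π∈U = ∈-map⁺ toLadder (tableaux-complete k k t)
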